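{- For every positive integer $k$, $$\sum_{r=1}^{2k} r!{2k\brace r}=\sum_{p=1}^{k}\sum_{q=1}^{k}{k\brace p}{k\brace q}\,p!\,q!\,D(p,q).$$
   Context: ${m\brace r}$ denotes the Stirling number of the second kind. The Delannoy numbers $D(m,n)$ for nonnegative integers $m,n$ are defined by $D(m,n)=1$ if $mn=0$, and $D(m,n)=D(m-1,n)+D(m-1,n-1)+D(m,n-1)$ if $mn\neq0$. -}

module Defs where

open import Data.Nat using (ℕ; zero; suc; _+_; _*_)

S : ℕ → ℕ → ℕ
S zero    zero    = 1
S zero    (suc r) = 0
S (suc n) zero    = 0
S (suc n) (suc r) = suc r * S n (suc r) + S n r

D : ℕ → ℕ → ℕ
D zero    n       = 1
D (suc m) zero    = 1
D (suc m) (suc n) = D m (suc n) + D m n + D (suc m) n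

sum1to : ℕ → (ℕ → ℕ) → ℕ
sum1to zero    f = 0
sum1to (suc n) f = sum1to n f + f (suc n)

{-# OPTIONS --safe #-}
module Submission where

-- With surj n r = r! S(n,r), the number of surjections of an n-set onto an r-set, the left
-- side is the Fubini number Σ_r surj (2k) r.  The recurrence surj (n+1) r = r (surj n r + surj n (r-1))
-- rewrites Σ_q surj (n+1) q g(q) as Σ_q surj n q g̃(q), where g̃(q) = q g(q) + (q+1) g(q+1),
-- and the Delannoy numbers satisfy p D(p,q) + (p+1) D(p+1,q) = q D(p,q) + (q+1) D(p,q+1):
-- applying ~ in either index of D gives the same result.  Hence
-- Φ m n = Σ_p Σ_q surj m p surj n q D(p,q) satisfies Φ (m+1) n = Φ m (n+1), so Φ k k = Φ (2k) 0,
-- which is the Fubini number because D(p,0) = 1.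

open import Defs
open import Data.Nat using (ℕ; zero; suc; _+_; _*_; _≤_; _<_; _!; s≤s)
open import Data.Nat.Properties
open import Data.Nat.Tactic.RingSolver using (solve-∀)
open import Relation.Binary.PropositionalEquality
open import Function using (_∘_)
open ≡-Reasoning

sumBelow : ℕ → (ℕ → ℕ) → ℕ
sumBelow zero    f = 0
sumBelow (suc n) f = sumBelow n f + f n

sumBelow-cong : ∀ n {f g : ℕ → ℕ} → (∀ i → f i ≡ g i) → sumBelow n f ≡ sumBelow n g
sumBelow-cong zero    f≗g = refl
sumBelow-cong (suc n) f≗g = cong₂ _+_ (sumBelow-cong n f≗g) (f≗g n)

sumBelow-+ : ∀ n (f g : ℕ → ℕ) → sumBelow n (λ i → f i + g i) ≡ sumBelow n f + sumBelow n g
sumBelow-+ zero    f g = refl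
sumBelow-+ (suc n) f g rewrite sumBelow-+ n f g = swap (sumBelow n f) (sumBelow n g) (f n) (g n)
  where
  swap : ∀ a b c d → a + b + (c + d) ≡ a + c + (b + d)
  swap = solve-∀

sumBelow-*ˡ : ∀ n c (f : ℕ → ℕ) → sumBelow n (λ i → c * f i) ≡ c * sumBelow n f
sumBelow-*ˡ zero    c f = sym (*-zeroʳ c)
sumBelow-*ˡ (suc n) c f rewrite sumBelow-*ˡ n c f = sym (*-distribˡ-+ c (sumBelow n f) (f n))

sumBelow-suc-shift : ∀ n (f : ℕ → ℕ) → sumBelow (suc n) f ≡ f 0 + sumBelow n (λ i → f (suc i))
sumBelow-suc-shift zero    f = +-comm 0 (f 0)
sumBelow-suc-shift (suc n) f rewrite sumBelow-suc-shift n f = +-assoc (f 0) _ _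

sumBelow-suc≡sum1to : ∀ n (f : ℕ → ℕ) → sumBelow (suc n) f ≡ f 0 + sum1to n f
sumBelow-suc≡sum1to zero    f = +-comm 0 (f 0)
sumBelow-suc≡sum1to (suc n) f rewrite sumBelow-suc≡sum1to n f = +-assoc (f 0) _ _

sumBelow-shift-vanishing-ends : ∀ n (f : ℕ → ℕ) → f 0 ≡ 0 → f (suc n) ≡ 0 →
  sumBelow (suc n) (λ i → f (suc i)) ≡ sumBelow (suc n) f
sumBelow-shift-vanishing-ends n f f0≡0 fn≡0 = begin
    sumBelow (suc n) (λ i → f (suc i))
  ≡⟨ cong (_+ sumBelow (suc n) (λ i → f (suc i))) (sym f0≡0) ⟩
    f 0 + sumBelow (suc n) (λ i → f (suc i))
  ≡⟨ sym (sumBelow-suc-shift (suc n) f) ⟩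
    sumBelow (suc n) f + f (suc n)
  ≡⟨ cong (sumBelow (suc n) f +_) fn≡0 ⟩
    sumBelow (suc n) f + 0
  ≡⟨ +-identityʳ _ ⟩
    sumBelow (suc n) f ∎

sum1to-cong : ∀ n {f g : ℕ → ℕ} → (∀ i → f i ≡ g i) → sum1to n f ≡ sum1to n g
sum1to-cong zero    f≗g = refl
sum1to-cong (suc n) f≗g = cong₂ _+_ (sum1to-cong n f≗g) (f≗g (suc n))

sum1to-*ˡ : ∀ n c (f : ℕ → ℕ) → sum1to n (λ i → c * f i) ≡ c * sum1to n f
sum1to-*ˡ zero    c f = sym (*-zeroʳ c)
sum1to-*ˡ (suc n) c f rewrite sum1to-*ˡ n c f = sym (*-distribˡ-+ c (sum1to n f) (f (suc n)))

shiftWeight : (ℕ → ℕ) → ℕ → ℕ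
shiftWeight g q = q * g q + suc q * g (suc q)

*-shiftWeight : ∀ c g q → c * shiftWeight g q ≡ shiftWeight (λ i → c * g i) q
*-shiftWeight c g q = distrib c q (g q) (suc q) (g (suc q))
  where
  distrib : ∀ c a x b y → c * (a * x + b * y) ≡ a * (c * x) + b * (c * y)
  distrib = solve-∀

sumBelow-shiftWeight : ∀ n (f : ℕ → ℕ → ℕ) p →
  sumBelow n (λ q → shiftWeight (f q) p) ≡ shiftWeight (λ i → sumBelow n (λ q → f q i)) p
sumBelow-shiftWeight n f p = begin
    sumBelow n (λ q → p * f q p + suc p * f q (suc p))
  ≡⟨ sumBelow-+ n _ _ ⟩
    sumBelow n (λ q → p * f q p) + sumBelow n (λ q → suc p * f q (suc p))
  ≡⟨ cong₂ _+_ (sumBelow-*ˡ n p _) (sumBelow-*ˡ n (suc p) _) ⟩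
    p * sumBelow n (λ q → f q p) + suc p * sumBelow n (λ q → f q (suc p)) ∎

surj : ℕ → ℕ → ℕ
surj zero    zero    = 1
surj zero    (suc r) = 0
surj (suc n) zero    = 0
surj (suc n) (suc r) = suc r * (surj n (suc r) + surj n r)

surj≡!*S : ∀ n r → surj n r ≡ (r !) * S n r
surj≡!*S zero    zero    = refl
surj≡!*S zero    (suc r) = sym (*-zeroʳ (suc r !))
surj≡!*S (suc n) zero    = refl
surj≡!*S (suc n) (suc r) rewrite surj≡!*S n (suc r) | surj≡!*S n r =
  regroup (suc r) (r !) (S n (suc r)) (S n r)
  where
  regroup : ∀ a b x y → a * (a * b * x + b * y) ≡ a * b * (a * x + y)
  regroup = solve-∀

surj-vanish : ∀ n r → n < r → surj n r ≡ 0
surj-vanish zero    (suc r) _        = refl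
surj-vanish (suc n) (suc r) (s≤s n<r)
  rewrite surj-vanish n (suc r) (m<n⇒m<1+n n<r) | surj-vanish n r n<r = *-zeroʳ (suc r)

sumBelow-surj-suc : ∀ n (g : ℕ → ℕ) →
  sumBelow (suc (suc n)) (λ q → surj (suc n) q * g q)
    ≡ sumBelow (suc n) (λ q → surj n q * shiftWeight g q)
sumBelow-surj-suc n g = begin
    sumBelow (suc (suc n)) (λ q → surj (suc n) q * g q)
  ≡⟨ sumBelow-suc-shift (suc n) _ ⟩
    sumBelow (suc n) (λ q → surj (suc n) (suc q) * g (suc q))
  ≡⟨ sumBelow-cong (suc n) (λ q → split (suc q) (surj n (suc q)) (surj n q) (g (suc q))) ⟩
    sumBelow (suc n) (λ q → h (suc q) + surj n q * (suc q * g (suc q)))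
  ≡⟨ sumBelow-+ (suc n) (λ q → h (suc q)) _ ⟩
    sumBelow (suc n) (λ q → h (suc q)) + sumBelow (suc n) (λ q → surj n q * (suc q * g (suc q)))
  ≡⟨ cong (_+ sumBelow (suc n) (λ q → surj n q * (suc q * g (suc q))))
       (sumBelow-shift-vanishing-ends n h refl h[n+1]≡0) ⟩
    sumBelow (suc n) h + sumBelow (suc n) (λ q → surj n q * (suc q * g (suc q)))
  ≡⟨ sym (sumBelow-+ (suc n) h _) ⟩
    sumBelow (suc n) (λ q → h q + surj n q * (suc q * g (suc q)))
  ≡⟨ sumBelow-cong (suc n) (λ q → factor q (surj n q) (g q) (g (suc q))) ⟩
    sumBelow (suc n) (λ q → surj n q * shiftWeight g q) ∎
  where
  h : ℕ → ℕ
  h q = q * surj n q * g q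
  h[n+1]≡0 : h (suc n) ≡ 0
  h[n+1]≡0 rewrite surj-vanish n (suc n) (n<1+n n) | *-zeroʳ (suc n) = refl
  split : ∀ a x y d → a * (x + y) * d ≡ a * x * d + y * (a * d)
  split = solve-∀
  factor : ∀ q x d e → q * x * d + x * (suc q * e) ≡ x * (q * d + suc q * e)
  factor = solve-∀

D[p,0]≡1 : ∀ p → D p 0 ≡ 1
D[p,0]≡1 zero    = refl
D[p,0]≡1 (suc p) = refl

D[1,q]≡2q+1 : ∀ q → D 1 q ≡ suc q + q
D[1,q]≡2q+1 zero    = refl
D[1,q]≡2q+1 (suc q) rewrite D[1,q]≡2q+1 q = cong (suc ∘ suc) (sym (+-suc q q))

D[p,1]≡2p+1 : ∀ p → D p 1 ≡ suc p + p
D[p,1]≡2p+1 zero    = refl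
D[p,1]≡2p+1 (suc p) rewrite D[p,1]≡2p+1 p | D[p,0]≡1 p = arith p
  where
  arith : ∀ p → suc p + p + 1 + 1 ≡ suc (suc p) + suc p
  arith = solve-∀

-- At (p+1, q+1), expanding each D by its recurrence turns the identity into the sum of
-- its instances at (p+1, q), (p, q+1) and (p, q).
shiftWeight-D-symmetric : ∀ p q → shiftWeight (λ i → D i q) p ≡ shiftWeight (D p) q
shiftWeight-D-symmetric zero q rewrite D[1,q]≡2q+1 q = arith q
  where
  arith : ∀ q → suc (q + q) + 0 ≡ q * 1 + suc q * 1
  arith = solve-∀
shiftWeight-D-symmetric (suc p) zero rewrite D[p,1]≡2p+1 (suc p) = arith p
  where
  arith : ∀ p → suc p * 1 + suc (suc p) * 1 ≡ suc (suc (p + suc p)) + 0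
  arith = solve-∀
shiftWeight-D-symmetric (suc p) (suc q) = +-cancelʳ-≡ _ _ _ (begin
    shiftWeight (λ i → D i (suc q)) (suc p) + instancesʳ
  ≡⟨ expand p q (D p q) (D p (suc q)) (D (suc p) q) (D p (suc (suc q))) (D (suc (suc p)) q) ⟩
    shiftWeight (D (suc p)) (suc q) + instancesˡ
  ≡⟨ cong (shiftWeight (D (suc p)) (suc q) +_) instancesˡ≡instancesʳ ⟩
    shiftWeight (D (suc p)) (suc q) + instancesʳ ∎)
  where
  sw = shiftWeight
  instancesˡ instancesʳ : ℕ
  instancesˡ = sw (λ i → D i q) (suc p) + sw (λ i → D i (suc q)) p + sw (λ i → D i q) p
  instancesʳ = sw (D (suc p)) q + sw (D p) (suc q) + sw (D p) q
  instancesˡ≡instancesʳ : instancesˡ ≡ instancesʳ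
  instancesˡ≡instancesʳ = cong₂ _+_
    (cong₂ _+_ (shiftWeight-D-symmetric (suc p) q) (shiftWeight-D-symmetric p (suc q)))
    (shiftWeight-D-symmetric p q)
  expand : ∀ p q a b c d e →
    (suc p * (b + a + c) + suc (suc p) * (b + a + c + c + e))
      + ((q * c + suc q * (b + a + c)) + (suc q * b + suc (suc q) * d) + (q * a + suc q * b))
    ≡ (suc q * (b + a + c) + suc (suc q) * (d + b + (b + a + c)))
      + ((suc p * c + suc (suc p) * e) + (p * b + suc p * (b + a + c)) + (p * a + suc p * c))
  expand = solve-∀

delannoyMoment : ℕ → ℕ → ℕ
delannoyMoment n p = sumBelow (suc n) (λ q → surj n q * D p q)

delannoyMoment-suc : ∀ n p → delannoyMoment (suc n) p ≡ shiftWeight (delannoyMoment n) p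
delannoyMoment-suc n p = begin
    delannoyMoment (suc n) p
  ≡⟨ sumBelow-surj-suc n (D p) ⟩
    sumBelow (suc n) (λ q → surj n q * shiftWeight (D p) q)
  ≡⟨ sumBelow-cong (suc n) (λ q → trans (cong (surj n q *_) (sym (shiftWeight-D-symmetric p q)))
                                        (*-shiftWeight (surj n q) (λ i → D i q) p)) ⟩
    sumBelow (suc n) (λ q → shiftWeight (λ i → surj n q * D i q) p)
  ≡⟨ sumBelow-shiftWeight (suc n) (λ q i → surj n q * D i q) p ⟩
    shiftWeight (delannoyMoment n) p ∎

fubini : ℕ → ℕ
fubini m = sumBelow (suc m) (surj m)

surjDelannoySum : ℕ → ℕ → ℕ
surjDelannoySum m n = sumBelow (suc m) (λ p → surj m p * delannoyMoment n p)

surjDelannoySum-zeroʳ : ∀ m → surjDelannoySum m 0 ≡ fubini m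
surjDelannoySum-zeroʳ m = sumBelow-cong (suc m) surj*moment₀
  where
  surj*moment₀ : ∀ p → surj m p * delannoyMoment 0 p ≡ surj m p
  surj*moment₀ p rewrite D[p,0]≡1 p = *-identityʳ (surj m p)

surjDelannoySum-transfer : ∀ m n → surjDelannoySum (suc m) n ≡ surjDelannoySum m (suc n)
surjDelannoySum-transfer m n = begin
    surjDelannoySum (suc m) n
  ≡⟨ sumBelow-surj-suc m (delannoyMoment n) ⟩
    sumBelow (suc m) (λ p → surj m p * shiftWeight (delannoyMoment n) p)
  ≡⟨ sumBelow-cong (suc m) (λ p → cong (surj m p *_) (sym (delannoyMoment-suc n p))) ⟩
    surjDelannoySum m (suc n) ∎

surjDelannoySum≡fubini : ∀ m n → surjDelannoySum m n ≡ fubini (m + n)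
surjDelannoySum≡fubini m zero    = trans (surjDelannoySum-zeroʳ m) (cong fubini (sym (+-identityʳ m)))
surjDelannoySum≡fubini m (suc n) = begin
    surjDelannoySum m (suc n)
  ≡⟨ sym (surjDelannoySum-transfer m n) ⟩
    surjDelannoySum (suc m) n
  ≡⟨ surjDelannoySum≡fubini (suc m) n ⟩
    fubini (suc m + n)
  ≡⟨ cong fubini (sym (+-suc m n)) ⟩
    fubini (m + suc n) ∎

corollary1 : (k : ℕ) → 1 ≤ k →
    sum1to (2 * k) (λ r → (r !) * S (2 * k) r)
      ≡ sum1to k (λ p → sum1to k (λ q → S k p * S k q * (p !) * (q !) * D p q))
corollary1 k@(suc _) _ = begin
    sum1to (2 * k) (λ r → (r !) * S (2 * k) r)
  ≡⟨ sum1to-cong (2 * k) (sym ∘ surj≡!*S (2 * k)) ⟩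
    sum1to (2 * k) (surj (2 * k))
  ≡⟨ sym (sumBelow-suc≡sum1to (2 * k) (surj (2 * k))) ⟩
    fubini (2 * k)
  ≡⟨ cong fubini (cong (k +_) (+-identityʳ k)) ⟩
    fubini (k + k)
  ≡⟨ sym (surjDelannoySum≡fubini k k) ⟩
    surjDelannoySum k k
  ≡⟨ sumBelow-suc≡sum1to k _ ⟩
    sum1to k (λ p → surj k p * delannoyMoment k p)
  ≡⟨ sum1to-cong k summand ⟩
    sum1to k (λ p → sum1to k (λ q → S k p * S k q * (p !) * (q !) * D p q)) ∎
  where
  summand : ∀ p → surj k p * delannoyMoment k p
                ≡ sum1to k (λ q → S k p * S k q * (p !) * (q !) * D p q)
  summand p rewrite sumBelow-suc≡sum1to k (λ q → surj k q * D p q) = begin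
      surj k p * sum1to k (λ q → surj k q * D p q)
    ≡⟨ sym (sum1to-*ˡ k (surj k p) _) ⟩
      sum1to k (λ q → surj k p * (surj k q * D p q))
    ≡⟨ sum1to-cong k (λ q → cong₂ (λ u v → u * (v * D p q)) (surj≡!*S k p) (surj≡!*S k q)) ⟩
      sum1to k (λ q → (p !) * S k p * ((q !) * S k q * D p q))
    ≡⟨ sum1to-cong k (λ q → regroup (p !) (q !) (S k p) (S k q) (D p q)) ⟩
      sum1to k (λ q → S k p * S k q * (p !) * (q !) * D p q) ∎
    where
    regroup : ∀ a b x y d → a * x * (b * y * d) ≡ x * y * a * b * d
    regroup = solve-∀
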